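{- For each $n\ge1$, the map sending a flag type $T$ of degree $n$ to the polyhedron $P_T\subseteq\mathbb R^{n-1}$ is injective.
   Context: Let $[n]=\{0,\dots,n-1\}$. A flag type of degree $n$ is a function $T:[n]\times[n]\to[n]$ such that $T(i,j)=T(j,i)$, $T(i,0)=i$, and $T(i,j)\le T(i+1,j)$ for $i<n-1$. For such $T$, $P_T$ is the set of $\mathbf x=(x_1,\dots,x_{n-1})\in\mathbb R^{n-1}$ with $0\le x_1\le\cdots\le x_{n-1}$ and $x_{T(i,j)}\le x_i+x_j$ for all $1\le i,j<n$. -}

module Defs where

open import Data.Nat using (ℕ; suc)
open import Data.Fin using (Fin; zero; suc; inject₁)
import Data.Fin as F
open import Data.Rational using (ℚ; 0ℚ; _+_; _≤_)
open import Data.Product using (_×_)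
open import Relation.Binary.PropositionalEquality using (_≡_)

record IsFlagType (m : ℕ) (T : Fin (suc m) → Fin (suc m) → Fin (suc m)) : Set where
  field
    symm  : ∀ i j → T i j ≡ T j i
    unitʳ : ∀ i → T i zero ≡ i
    mono  : ∀ (i : Fin m) j → T (inject₁ i) j F.≤ T (suc i) j

-- Points x = (x_1,…,x_{n-1}) ∈ ℚ^{n-1}, coordinate x_{k+1} stored at index k : Fin m.
-- ext x is (x_0, x_1, …, x_{n-1}) with the convention x_0 = 0.
ext : ∀ {m} → (Fin m → ℚ) → Fin (suc m) → ℚ
ext x zero    = 0ℚ
ext x (suc k) = x k

InP : ∀ {m} → (Fin (suc m) → Fin (suc m) → Fin (suc m)) → (Fin m → ℚ) → Set
InP {m} T x =
  (∀ (i : Fin m) → ext x (inject₁ i) ≤ ext x (suc i)) ×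
  (∀ (i j : Fin m) → ext x (T (suc i) (suc j)) ≤ x i + x j)

{-# OPTIONS --safe #-}
-- For 1 ≤ I ≤ J and K = T(I,J), the staircase point with x_0 = 0 and x_l = 2, 3, 4, 6 for l in
-- (0,I], (I,J], (J,K], (K,n) lies in P_T. Since x_I + x_J = 5 < 6, it lies in P_{T′} only if
-- T′(I,J) ≤ K. So P_T ⊆ P_{T′} forces T′ ≤ T pointwise, and equal polyhedra give equal flag types.
module Submission where

open import Defs
open import Data.Nat using (ℕ; suc)
open import Data.Fin using (Fin)
open import Data.Rational using (ℚ)
open import Relation.Binary.PropositionalEquality using (_≡_)

open import Data.Nat as ℕ using (zero; z≤n; s≤s; _≤?_)
import Data.Nat.Properties as ℕ
open import Data.Fin as F using (zero; suc; inject₁; toℕ)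
import Data.Fin.Properties as F
open import Data.Integer as ℤ using (+_)
import Data.Integer.Properties as ℤ
import Data.Rational as ℚ
open import Data.Rational.Literals using (fromℤ)
open import Data.Rational.Properties using (↥p/↧p≡p; /-cong)
open import Data.Product using (_,_)
open import Data.Sum using (inj₁; inj₂)
open import Relation.Nullary using (Dec; yes; no; contradiction)
open import Relation.Binary.PropositionalEquality
  using (refl; sym; trans; cong; cong₂; subst; subst₂)

fromℕ : ℕ → ℚ
fromℕ n = fromℤ (+ n)

fromℕ-homo-+ : ∀ a b → fromℕ a ℚ.+ fromℕ b ≡ fromℕ (a ℕ.+ b)
fromℕ-homo-+ a b = trans (/-cong numerator refl) (↥p/↧p≡p (fromℕ (a ℕ.+ b)))
  where
  numerator : + a ℤ.* + 1 ℤ.+ + b ℤ.* + 1 ≡ + (a ℕ.+ b)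
  numerator = trans (cong₂ ℤ._+_ (ℤ.*-identityʳ (+ a)) (ℤ.*-identityʳ (+ b)))
                    (sym (ℤ.pos-+ a b))

fromℕ-mono-≤ : ∀ {a b} → a ℕ.≤ b → fromℕ a ℚ.≤ fromℕ b
fromℕ-mono-≤ {a} {b} a≤b =
  ℚ.*≤* (subst₂ ℤ._≤_ (sym (ℤ.*-identityʳ (+ a))) (sym (ℤ.*-identityʳ (+ b))) (ℤ.+≤+ a≤b))

fromℕ-cancel-≤ : ∀ {a b} → fromℕ a ℚ.≤ fromℕ b → a ℕ.≤ b
fromℕ-cancel-≤ {a} {b} (ℚ.*≤* a≤b) =
  ℤ.drop‿+≤+ (subst₂ ℤ._≤_ (ℤ.*-identityʳ (+ a)) (ℤ.*-identityʳ (+ b)) a≤b)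

stepwise⇒monotone : ∀ {m} (f : Fin (suc m) → ℕ) → (∀ i → f (inject₁ i) ℕ.≤ f (suc i)) →
                    ∀ {a b} → a F.≤ b → f a ℕ.≤ f b
stepwise⇒monotone f step {zero}  {zero}  _ = ℕ.≤-refl
stepwise⇒monotone {suc m} f step {zero} {suc b} _ =
  ℕ.≤-trans (step zero) (stepwise⇒monotone (λ c → f (suc c)) (λ i → step (suc i)) {zero} {b} z≤n)
stepwise⇒monotone {suc m} f step {suc a} {suc b} (s≤s a≤b) =
  stepwise⇒monotone (λ c → f (suc c)) (λ i → step (suc i)) a≤b

module FlagType {m : ℕ} {T : Fin (suc m) → Fin (suc m) → Fin (suc m)} (flag : IsFlagType m T) where
  open IsFlagType flag

  unitˡ : ∀ j → T zero j ≡ j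
  unitˡ j = trans (symm zero j) (unitʳ j)

  monoˡ : ∀ {a a′} b → a F.≤ a′ → T a b F.≤ T a′ b
  monoˡ b = stepwise⇒monotone (λ a → toℕ (T a b)) (λ i → mono i b)

  mono₂ : ∀ {a a′ b b′} → a F.≤ a′ → b F.≤ b′ → T a b F.≤ T a′ b′
  mono₂ {a} {a′} {b} {b′} a≤a′ b≤b′ = F.≤-trans (monoˡ b a≤a′)
    (subst₂ F._≤_ (symm b a′) (symm b′ a′) (monoˡ a′ b≤b′))

  ≤-applyʳ : ∀ i j → j F.≤ T i j
  ≤-applyʳ i j = subst (F._≤ T i j) (unitˡ j) (monoˡ j (z≤n {toℕ i}))

point : ∀ {m} → (ℕ → ℕ) → Fin m → ℚ
point f l = fromℕ (f (suc (toℕ l)))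

module _ {m : ℕ} {T : Fin (suc m) → Fin (suc m) → Fin (suc m)} {f : ℕ → ℕ} (f0≡0 : f 0 ≡ 0) where

  ext-point : ∀ c → ext (point {m} f) c ≡ fromℕ (f (toℕ c))
  ext-point zero    = cong fromℕ (sym f0≡0)
  ext-point (suc c) = refl

  point∈P : (∀ l → f l ℕ.≤ f (suc l)) →
            (∀ a b → f (toℕ (T (suc a) (suc b))) ℕ.≤ f (suc (toℕ a)) ℕ.+ f (suc (toℕ b))) →
            InP T (point f)
  point∈P step subadd = ordered , subadditive
    where
    ordered : ∀ i → ext (point f) (inject₁ i) ℚ.≤ ext (point f) (suc i)
    ordered i = subst (ℚ._≤ point f i) (sym (ext-point (inject₁ i)))
      (fromℕ-mono-≤ (subst (λ l → f l ℕ.≤ f (suc (toℕ i))) (sym (F.toℕ-inject₁ i)) (step (toℕ i))))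
    subadditive : ∀ a b → ext (point f) (T (suc a) (suc b)) ℚ.≤ point f a ℚ.+ point f b
    subadditive a b = subst₂ ℚ._≤_ (sym (ext-point (T (suc a) (suc b))))
      (sym (fromℕ-homo-+ (f (suc (toℕ a))) (f (suc (toℕ b)))))
      (fromℕ-mono-≤ (subadd a b))

  point∈P⇒subadditive : InP T (point f) →
    ∀ a b → f (toℕ (T (suc a) (suc b))) ℕ.≤ f (suc (toℕ a)) ℕ.+ f (suc (toℕ b))
  point∈P⇒subadditive (_ , subadditive) a b = fromℕ-cancel-≤
    (subst₂ ℚ._≤_ (ext-point (T (suc a) (suc b)))
      (fromℕ-homo-+ (f (suc (toℕ a))) (f (suc (toℕ b))))
      (subadditive a b))

module Staircase (I J K : ℕ) where

  stairs : ℕ → ℕ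
  stairs zero = 0
  stairs (suc l) with suc l ≤? I | suc l ≤? J | suc l ≤? K
  ... | yes _ | _     | _     = 2
  ... | no _  | yes _ | _     = 3
  ... | no _  | no _  | yes _ = 4
  ... | no _  | no _  | no _  = 6

  stairs≤2 : ∀ {l} → l ℕ.≤ I → stairs l ℕ.≤ 2
  stairs≤2 {zero} _ = z≤n
  stairs≤2 {suc l} l≤I with suc l ≤? I | suc l ≤? J | suc l ≤? K
  ... | yes _  | _ | _ = ℕ.≤-refl
  ... | no l≰I | _ | _ = contradiction l≤I l≰I

  stairs≤3 : ∀ {l} → l ℕ.≤ J → stairs l ℕ.≤ 3
  stairs≤3 {zero} _ = z≤n
  stairs≤3 {suc l} l≤J with suc l ≤? I | suc l ≤? J | suc l ≤? K
  ... | yes _ | _      | _ = s≤s (s≤s z≤n)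
  ... | no _  | yes _  | _ = ℕ.≤-refl
  ... | no _  | no l≰J | _ = contradiction l≤J l≰J

  stairs≤4 : ∀ {l} → l ℕ.≤ K → stairs l ℕ.≤ 4
  stairs≤4 {zero} _ = z≤n
  stairs≤4 {suc l} l≤K with suc l ≤? I | suc l ≤? J | suc l ≤? K
  ... | yes _ | _     | _      = s≤s (s≤s z≤n)
  ... | no _  | yes _ | _      = s≤s (s≤s (s≤s z≤n))
  ... | no _  | no _  | yes _  = ℕ.≤-refl
  ... | no _  | no _  | no l≰K = contradiction l≤K l≰K

  stairs≤6 : ∀ l → stairs l ℕ.≤ 6
  stairs≤6 zero = z≤n
  stairs≤6 (suc l) with suc l ≤? I | suc l ≤? J | suc l ≤? K
  ... | yes _ | _     | _     = s≤s (s≤s z≤n)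
  ... | no _  | yes _ | _     = s≤s (s≤s (s≤s z≤n))
  ... | no _  | no _  | yes _ = s≤s (s≤s (s≤s (s≤s z≤n)))
  ... | no _  | no _  | no _  = ℕ.≤-refl

  2≤stairs : ∀ l → 2 ℕ.≤ stairs (suc l)
  2≤stairs l with suc l ≤? I | suc l ≤? J | suc l ≤? K
  ... | yes _ | _     | _     = s≤s (s≤s z≤n)
  ... | no _  | yes _ | _     = s≤s (s≤s z≤n)
  ... | no _  | no _  | yes _ = s≤s (s≤s z≤n)
  ... | no _  | no _  | no _  = s≤s (s≤s z≤n)

  3≤stairs : ∀ {l} → I ℕ.< l → 3 ℕ.≤ stairs l
  3≤stairs {suc l} I<l with suc l ≤? I | suc l ≤? J | suc l ≤? K
  ... | yes l≤I | _     | _     = contradiction l≤I (ℕ.<⇒≱ I<l)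
  ... | no _    | yes _ | _     = s≤s (s≤s (s≤s z≤n))
  ... | no _    | no _  | yes _ = s≤s (s≤s (s≤s z≤n))
  ... | no _    | no _  | no _  = s≤s (s≤s (s≤s z≤n))

  4≤stairs : I ℕ.≤ J → ∀ {l} → J ℕ.< l → 4 ℕ.≤ stairs l
  4≤stairs I≤J {suc l} J<l with suc l ≤? I | suc l ≤? J | suc l ≤? K
  ... | yes l≤I | _       | _     = contradiction (ℕ.≤-trans l≤I I≤J) (ℕ.<⇒≱ J<l)
  ... | no _    | yes l≤J | _     = contradiction l≤J (ℕ.<⇒≱ J<l)
  ... | no _    | no _    | yes _ = s≤s (s≤s (s≤s (s≤s z≤n)))
  ... | no _    | no _    | no _  = s≤s (s≤s (s≤s (s≤s z≤n)))

  6≤stairs : I ℕ.≤ J → J ℕ.≤ K → ∀ {l} → K ℕ.< l → 6 ℕ.≤ stairs l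
  6≤stairs I≤J J≤K {suc l} K<l with suc l ≤? I | suc l ≤? J | suc l ≤? K
  ... | yes l≤I | _       | _       =
    contradiction (ℕ.≤-trans l≤I (ℕ.≤-trans I≤J J≤K)) (ℕ.<⇒≱ K<l)
  ... | no _    | yes l≤J | _       = contradiction (ℕ.≤-trans l≤J J≤K) (ℕ.<⇒≱ K<l)
  ... | no _    | no _    | yes l≤K = contradiction l≤K (ℕ.<⇒≱ K<l)
  ... | no _    | no _    | no _    = ℕ.≤-refl

  stairs-mono : ∀ {l l′} → l ℕ.≤ l′ → stairs l ℕ.≤ stairs l′
  stairs-mono {zero} _ = z≤n
  stairs-mono {suc l} {suc l′} l≤l′ with suc l′ ≤? I | suc l′ ≤? J | suc l′ ≤? K
  ... | yes l′≤I | _        | _        = stairs≤2 (ℕ.≤-trans l≤l′ l′≤I)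
  ... | no _     | yes l′≤J | _        = stairs≤3 (ℕ.≤-trans l≤l′ l′≤J)
  ... | no _     | no _     | yes l′≤K = stairs≤4 (ℕ.≤-trans l≤l′ l′≤K)
  ... | no _     | no _     | no _     = stairs≤6 (suc l)

  -- Outside the boxes [1,I]×[1,J] and [1,J]×[1,I] one of a, b exceeds J or both exceed I,
  -- so x_a + x_b ≥ 6; inside them c ≤ K gives x_c ≤ 4 = 2 + 2.
  stairs-subadditive : I ℕ.≤ J → J ℕ.≤ K → ∀ a b c →
    (suc a ℕ.≤ I → suc b ℕ.≤ J → c ℕ.≤ K) → (suc a ℕ.≤ J → suc b ℕ.≤ I → c ℕ.≤ K) →
    stairs c ℕ.≤ stairs (suc a) ℕ.+ stairs (suc b)
  stairs-subadditive I≤J J≤K a b c box₁ box₂ =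
    cases (suc a ≤? J) (suc b ≤? J) (suc a ≤? I) (suc b ≤? I)
    where
    cases : Dec (suc a ℕ.≤ J) → Dec (suc b ℕ.≤ J) → Dec (suc a ℕ.≤ I) → Dec (suc b ℕ.≤ I) →
            stairs c ℕ.≤ stairs (suc a) ℕ.+ stairs (suc b)
    cases (no a≰J) _ _ _ =
      ℕ.≤-trans (stairs≤6 c) (ℕ.+-mono-≤ (4≤stairs I≤J (ℕ.≰⇒> a≰J)) (2≤stairs b))
    cases (yes _) (no b≰J) _ _ =
      ℕ.≤-trans (stairs≤6 c) (ℕ.+-mono-≤ (2≤stairs a) (4≤stairs I≤J (ℕ.≰⇒> b≰J)))
    cases (yes _) (yes b≤J) (yes a≤I) _ =
      ℕ.≤-trans (stairs≤4 (box₁ a≤I b≤J)) (ℕ.+-mono-≤ (2≤stairs a) (2≤stairs b))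
    cases (yes a≤J) (yes _) (no _) (yes b≤I) =
      ℕ.≤-trans (stairs≤4 (box₂ a≤J b≤I)) (ℕ.+-mono-≤ (2≤stairs a) (2≤stairs b))
    cases (yes _) (yes _) (no a≰I) (no b≰I) =
      ℕ.≤-trans (stairs≤6 c) (ℕ.+-mono-≤ (3≤stairs (ℕ.≰⇒> a≰I)) (3≤stairs (ℕ.≰⇒> b≰I)))

module _ {m : ℕ} {T₀ T₁ : Fin (suc m) → Fin (suc m) → Fin (suc m)}
         (flag₀ : IsFlagType m T₀) (flag₁ : IsFlagType m T₁)
         (P₀⊆P₁ : ∀ x → InP T₀ x → InP T₁ x) where

  private
    module F₀ = FlagType flag₀
    module F₁ = FlagType flag₁
    open IsFlagType

  P-⊆⇒T-≥-ordered : ∀ i j → i F.≤ j → T₁ (suc i) (suc j) F.≤ T₀ (suc i) (suc j)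
  P-⊆⇒T-≥-ordered i j i≤j = ℕ.≮⇒≥ λ K<K′ → ℕ.<⇒≱ (s≤s x[K′]≤5) (6≤stairs I≤J J≤K K<K′)
    where
    I J K K′ : ℕ
    I  = suc (toℕ i)
    J  = suc (toℕ j)
    K  = toℕ (T₀ (suc i) (suc j))
    K′ = toℕ (T₁ (suc i) (suc j))
    open Staircase I J K

    I≤J : I ℕ.≤ J
    I≤J = s≤s i≤j

    J≤K : J ℕ.≤ K
    J≤K = F₀.≤-applyʳ (suc i) (suc j)

    x∈P₀ : InP T₀ (point stairs)
    x∈P₀ = point∈P {T = T₀} {f = stairs} refl (λ l → stairs-mono (ℕ.n≤1+n l)) λ a b →
      stairs-subadditive I≤J J≤K (toℕ a) (toℕ b) _ F₀.mono₂
        (λ a≤J b≤I → subst (λ c → T₀ (suc a) (suc b) F.≤ c) (symm flag₀ (suc j) (suc i))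
                           (F₀.mono₂ a≤J b≤I))

    x[K′]≤5 : stairs K′ ℕ.≤ 5
    x[K′]≤5 =
      ℕ.≤-trans (point∈P⇒subadditive {T = T₁} {f = stairs} refl (P₀⊆P₁ (point stairs) x∈P₀) i j)
                (ℕ.+-mono-≤ (stairs≤2 ℕ.≤-refl) (stairs≤3 ℕ.≤-refl))

  P-⊆⇒T-≥ : ∀ i j → T₁ i j F.≤ T₀ i j
  P-⊆⇒T-≥ zero    j       = F.≤-reflexive (trans (F₁.unitˡ j) (sym (F₀.unitˡ j)))
  P-⊆⇒T-≥ (suc i) zero    = F.≤-reflexive (trans (unitʳ flag₁ (suc i)) (sym (unitʳ flag₀ (suc i))))
  P-⊆⇒T-≥ (suc i) (suc j) with F.≤-total i j
  ... | inj₁ i≤j = P-⊆⇒T-≥-ordered i j i≤j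
  ... | inj₂ j≤i = subst₂ F._≤_ (symm flag₁ (suc j) (suc i)) (symm flag₀ (suc j) (suc i))
                          (P-⊆⇒T-≥-ordered j i j≤i)

lemma1p16 : (m : ℕ) (T T′ : Fin (suc m) → Fin (suc m) → Fin (suc m)) →
    IsFlagType m T → IsFlagType m T′ →
    (∀ (x : Fin m → ℚ) → (InP T x → InP T′ x)) →
    (∀ (x : Fin m → ℚ) → (InP T′ x → InP T x)) →
    ∀ i j → T i j ≡ T′ i j
lemma1p16 m T T′ flag flag′ P⊆P′ P′⊆P i j =
  F.≤-antisym (P-⊆⇒T-≥ flag′ flag P′⊆P i j) (P-⊆⇒T-≥ flag flag′ P⊆P′ i j)
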